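{- An inversion sequence is stack sortable if and only if it avoids the pattern $120$.
   Context: An inversion sequence of length $n$ is a word $e=e_1\cdots e_n$ of integers with $0\le e_i\le i-1$ for each $i$. A word $w=w_1\cdots w_n$ contains a pattern $p=p_1\cdots p_k$ if there are indices $1\le \alpha_1<\cdots<\alpha_k\le n$ such that for all $i,j$: $w_{\alpha_i}<w_{\alpha_j}$ iff $p_i<p_j$, and $w_{\alpha_i}=w_{\alpha_j}$ iff $p_i=p_j$; otherwise $w$ avoids $p$. A stack is a last-in first-out device: entries of the word are read left to right; a push moves the next input entry onto the top of the stack, a pop moves the top entry of the stack to the end of the output. A word is stack sortable if some sequence of pushes and pops outputs all its entries in weakly increasing order. -}

module Defs where

open import Data.Nat using (ℕ; zero; suc; _≤_; _<_)
open import Data.List using (List; []; _∷_; length; lookup; reverse; _++_; [_])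
open import Data.List.Relation.Unary.AllPairs using (AllPairs)
open import Data.List.Relation.Binary.Sublist.Propositional using (_⊆_)
open import Data.Fin using (Fin; cast)
open import Data.Product using (Σ; _×_; _,_; ∃; ∃-syntax)
open import Relation.Binary.PropositionalEquality using (_≡_)
open import Relation.Nullary using (¬_)
open import Function.Bundles using (_⇔_)

-- Inversion sequence of length n: e₁ ⋯ eₙ with 0 ≤ eᵢ ≤ i - 1.
-- InvSeqFrom k e : the entries of e, read as positions k+1, k+2, …,
-- satisfy eᵢ ≤ i - 1 (i.e. the j-th entry from here is ≤ k + j - 1, 0-indexed ≤ k+j).
data InvSeqFrom : ℕ → List ℕ → Set where
  []  : ∀ {k} → InvSeqFrom k []
  _∷_ : ∀ {k x xs} → x ≤ k → InvSeqFrom (suc k) xs → InvSeqFrom k (x ∷ xs)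

IsInversionSequence : List ℕ → Set
IsInversionSequence e = InvSeqFrom 0 e

OrderIso : (u p : List ℕ) → Set
OrderIso u p = Σ (length u ≡ length p) λ eq →
  ∀ (i j : Fin (length u)) →
    ((lookup u i < lookup u j) ⇔ (lookup p (cast eq i) < lookup p (cast eq j)))
    × ((lookup u i ≡ lookup u j) ⇔ (lookup p (cast eq i) ≡ lookup p (cast eq j)))

Contains : (w p : List ℕ) → Set
Contains w p = ∃[ u ] (u ⊆ w × OrderIso u p)

Avoids : (w p : List ℕ) → Set
Avoids w p = ¬ Contains w p

-- Stack machine. A configuration is (remaining input, stack (head = top),
-- output so far). Output is kept in order (new entries appended at end).
data Step : (List ℕ × List ℕ × List ℕ) → (List ℕ × List ℕ × List ℕ) → Set where
  push : ∀ {x inp st out} → Step (x ∷ inp , st , out) (inp , x ∷ st , out)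
  pop  : ∀ {x inp st out} → Step (inp , x ∷ st , out) (inp , st , out ++ [ x ])

data Steps : (List ℕ × List ℕ × List ℕ) → (List ℕ × List ℕ × List ℕ) → Set where
  done : ∀ {c} → Steps c c
  step : ∀ {c d e} → Step c d → Steps d e → Steps c e

WeaklyIncreasing : List ℕ → Set
WeaklyIncreasing = AllPairs _≤_

StackSortable : List ℕ → Set
StackSortable w = ∃[ out ] (Steps (w , [] , []) ([] , [] , out) × WeaklyIncreasing out)

pat120 : List ℕ
pat120 = 1 ∷ 2 ∷ 0 ∷ []

-- Call a configuration (input, stack, output) of the stack Good if the input avoids 120, the stack
-- is weakly increasing from its top, the output is weakly increasing and below every pending entry,
-- and no stack entry s is straddled by the input: the input never has some x > s followed by some
-- y < s.  A straddled s is doomed, since it must stay on the stack until y has been output, so x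
-- lands on top of it and leaves before it.  Every step preserves Goodness backwards, so a sortable
-- word avoids 120; conversely the greedy strategy (push when the next entry does not exceed the top
-- of the stack, pop otherwise) preserves it forwards and therefore sorts every Good configuration.

module Submission where

open import Defs
open import Data.Nat using (ℕ; _≤_; _<_; z<s; s<s)
open import Data.Nat.Properties using (≤-trans; <⇒≤; <⇒≱; ≮⇒≥; ≤-<-connex; <-irrefl; <-asym; <-trans; <⇒≢)
open import Data.List using (List; []; _∷_; _++_; [_])
open import Data.List.Relation.Unary.All as All using (All; []; _∷_)
import Data.List.Relation.Unary.All.Properties as Allₚ
open import Data.List.Relation.Unary.AllPairs as AllPairs using (AllPairs; []; _∷_)
import Data.List.Relation.Unary.AllPairs.Properties as AllPairsₚ
open import Data.List.Relation.Binary.Sublist.Propositional using (_⊆_; _∷_; _∷ʳ_; from∈)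
open import Data.List.Relation.Binary.Sublist.Propositional.Properties using (All-resp-⊆)
open import Data.Fin using () renaming (zero to fzero; suc to fsuc)
open import Data.Product using (_×_; _,_; ∃-syntax; proj₁)
open import Data.Sum using (_⊎_; inj₁; inj₂; [_,_]′)
open import Data.Empty using (⊥-elim)
open import Function using (_∘_)
open import Function.Bundles using (_⇔_; mk⇔; Equivalence)
open import Relation.Binary.PropositionalEquality using (_≡_; refl; sym)
open import Relation.Nullary using (¬_)

Contains120 : List ℕ → Set
Contains120 w = ∃[ a ] ∃[ b ] ∃[ c ] ((b ∷ c ∷ a ∷ []) ⊆ w × a < b × b < c)

Straddles : ℕ → List ℕ → Set
Straddles s w = ∃[ x ] ∃[ y ] ((x ∷ y ∷ []) ⊆ w × y < s × s < x)

SameOrder : (x y p q : ℕ) → Set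
SameOrder x y p q = ((x < y) ⇔ (p < q)) × ((x ≡ y) ⇔ (p ≡ q))

same-order-≡ : ∀ x p → SameOrder x x p p
same-order-≡ x p = mk⇔ (⊥-elim ∘ <-irrefl refl) (⊥-elim ∘ <-irrefl refl)
                 , mk⇔ (λ _ → refl) (λ _ → refl)

same-order-< : ∀ {x y p q} → x < y → p < q → SameOrder x y p q
same-order-< x<y p<q = mk⇔ (λ _ → p<q) (λ _ → x<y)
                     , mk⇔ (⊥-elim ∘ <⇒≢ x<y) (⊥-elim ∘ <⇒≢ p<q)

same-order-> : ∀ {x y p q} → y < x → q < p → SameOrder x y p q
same-order-> y<x q<p = mk⇔ (⊥-elim ∘ <-asym y<x) (⊥-elim ∘ <-asym q<p)
                     , mk⇔ (⊥-elim ∘ <⇒≢ y<x ∘ sym) (⊥-elim ∘ <⇒≢ q<p ∘ sym)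

order-iso-120 : ∀ {a b c} → a < b → b < c → OrderIso (b ∷ c ∷ a ∷ []) pat120
order-iso-120 {a} {b} {c} a<b b<c = refl , λ where
  fzero               fzero               → same-order-≡ b 1
  fzero               (fsuc fzero)        → same-order-< b<c (s<s z<s)
  fzero               (fsuc (fsuc fzero)) → same-order-> a<b z<s
  (fsuc fzero)        fzero               → same-order-> b<c (s<s z<s)
  (fsuc fzero)        (fsuc fzero)        → same-order-≡ c 2
  (fsuc fzero)        (fsuc (fsuc fzero)) → same-order-> (<-trans a<b b<c) z<s
  (fsuc (fsuc fzero)) fzero               → same-order-< a<b z<s
  (fsuc (fsuc fzero)) (fsuc fzero)        → same-order-< (<-trans a<b b<c) z<s
  (fsuc (fsuc fzero)) (fsuc (fsuc fzero)) → same-order-≡ a 0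

contains-pat120⇔Contains120 : ∀ {w} → Contains w pat120 ⇔ Contains120 w
contains-pat120⇔Contains120 = mk⇔ to from
  where
  to : ∀ {w} → Contains w pat120 → Contains120 w
  to (b ∷ c ∷ a ∷ [] , sub , _ , iso) =
    a , b , c , sub , Equivalence.from (proj₁ (iso (fsuc (fsuc fzero)) fzero)) z<s
                    , Equivalence.from (proj₁ (iso fzero (fsuc fzero))) (s<s z<s)

  from : ∀ {w} → Contains120 w → Contains w pat120
  from (a , b , c , sub , a<b , b<c) = b ∷ c ∷ a ∷ [] , sub , order-iso-120 a<b b<c

contains120-∷ : ∀ {x w} → Contains120 (x ∷ w) ⇔ (Contains120 w ⊎ Straddles x w)
contains120-∷ {x} = mk⇔ to from
  where
  to : ∀ {w} → Contains120 (x ∷ w) → Contains120 w ⊎ Straddles x w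
  to (a , b , c , (_ ∷ʳ sub) , a<b , b<c) = inj₁ (a , b , c , sub , a<b , b<c)
  to (a , b , c , (refl ∷ sub) , a<b , b<c) = inj₂ (c , a , sub , a<b , b<c)

  from : ∀ {w} → Contains120 w ⊎ Straddles x w → Contains120 (x ∷ w)
  from (inj₁ (a , b , c , sub , a<b , b<c)) = a , b , c , x ∷ʳ sub , a<b , b<c
  from (inj₂ (c , a , sub , a<x , x<c)) = a , x , c , refl ∷ sub , a<x , x<c

straddles-∷ʳ : ∀ {s x w} → Straddles s w → Straddles s (x ∷ w)
straddles-∷ʳ {x = x} (u , v , sub , v<s , s<u) = u , v , x ∷ʳ sub , v<s , s<u

¬straddles-∷ : ∀ {s x w} → x ≤ s → ¬ Straddles s w → ¬ Straddles s (x ∷ w)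
¬straddles-∷ x≤s ¬st (u , v , (_ ∷ʳ sub) , v<s , s<u) = ¬st (u , v , sub , v<s , s<u)
¬straddles-∷ x≤s ¬st (_ , _ , (refl ∷ _) , _ , s<x) = <⇒≱ s<x x≤s

lower-bound⇒¬straddles : ∀ {s w} → All (s ≤_) w → ¬ Straddles s w
lower-bound⇒¬straddles s≤w (_ , _ , sub , v<s , _) with All-resp-⊆ sub s≤w
... | _ ∷ s≤v ∷ [] = <⇒≱ v<s s≤v

¬straddles⇒lower-bound : ∀ {s x w} → ¬ Straddles s (x ∷ w) → s < x → All (s ≤_) w
¬straddles⇒lower-bound {x = x} ¬st s<x =
  All.tabulate λ {v} v∈w → ≮⇒≥ λ v<s → ¬st (x , v , refl ∷ from∈ v∈w , v<s , s<x)

allPairs-∷ʳ⁻ : ∀ {R : ℕ → ℕ → Set} xs {x} →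
               AllPairs R (xs ++ [ x ]) → AllPairs R xs × All (λ y → R y x) xs
allPairs-∷ʳ⁻ [] _ = [] , []
allPairs-∷ʳ⁻ (y ∷ xs) (y-xs ∷ xs-sorted) with Allₚ.∷ʳ⁻ y-xs | allPairs-∷ʳ⁻ xs xs-sorted
... | y-init , Ryx | init-sorted , init-x = (y-init ∷ init-sorted) , (Ryx ∷ init-x)

record Good (inp st out : List ℕ) : Set where
  field
    input-avoids      : ¬ Contains120 inp
    stack-unstraddled : All (λ s → ¬ Straddles s inp) st
    stack-sorted      : WeaklyIncreasing st
    output-sorted     : WeaklyIncreasing out
    output-below      : All (λ o → All (o ≤_) st × All (o ≤_) inp) out
open Good

Completable : (inp st out : List ℕ) → Set
Completable inp st out = ∃[ fin ] (Steps (inp , st , out) ([] , [] , fin) × WeaklyIncreasing fin)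

good-initial : ∀ {w} → ¬ Contains120 w → Good w [] []
good-initial avoids = record
  { input-avoids = avoids ; stack-unstraddled = [] ; stack-sorted = []
  ; output-sorted = [] ; output-below = [] }

good-final : ∀ {fin} → WeaklyIncreasing fin → Good [] [] fin
good-final {fin} sorted = record
  { input-avoids = λ { (_ , _ , _ , () , _) } ; stack-unstraddled = [] ; stack-sorted = []
  ; output-sorted = sorted ; output-below = All.universal (λ _ → [] , []) fin }

good-before-push : ∀ {x inp st out} → Good inp (x ∷ st) out → Good (x ∷ inp) st out
good-before-push g with stack-sorted g
... | x≤st ∷ st-sorted = record
  { input-avoids = [ input-avoids g , All.head (stack-unstraddled g) ]′ ∘ Equivalence.to contains120-∷
  ; stack-unstraddled = All.zipWith (λ (x≤s , ¬st) → ¬straddles-∷ x≤s ¬st)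
                                    (x≤st , All.tail (stack-unstraddled g))
  ; stack-sorted = st-sorted
  ; output-sorted = output-sorted g
  ; output-below = All.map (λ { ((o≤x ∷ o≤st) , o≤inp) → o≤st , o≤x ∷ o≤inp }) (output-below g)
  }

good-before-pop : ∀ {s inp st out} → Good inp st (out ++ [ s ]) → Good inp (s ∷ st) out
good-before-pop {out = out} g with Allₚ.∷ʳ⁻ (output-below g) | allPairs-∷ʳ⁻ out (output-sorted g)
... | out-below , (s≤st , s≤inp) | out-sorted , out≤s = record
  { input-avoids = input-avoids g
  ; stack-unstraddled = lower-bound⇒¬straddles s≤inp ∷ stack-unstraddled g
  ; stack-sorted = s≤st ∷ stack-sorted g
  ; output-sorted = out-sorted
  ; output-below = All.zipWith (λ { (o≤s , (o≤st , o≤inp)) → (o≤s ∷ o≤st) , o≤inp }) (out≤s , out-below)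
  }

good-after-push : ∀ {x inp st out} → All (x ≤_) st → Good (x ∷ inp) st out → Good inp (x ∷ st) out
good-after-push x≤st g = record
  { input-avoids = input-avoids g ∘ Equivalence.from contains120-∷ ∘ inj₁
  ; stack-unstraddled = input-avoids g ∘ Equivalence.from contains120-∷ ∘ inj₂
                        ∷ All.map (_∘ straddles-∷ʳ) (stack-unstraddled g)
  ; stack-sorted = x≤st ∷ stack-sorted g
  ; output-sorted = output-sorted g
  ; output-below = All.map (λ { (o≤st , (o≤x ∷ o≤inp)) → (o≤x ∷ o≤st) , o≤inp }) (output-below g)
  }

good-after-pop : ∀ {s inp st out} → All (s ≤_) inp → Good inp (s ∷ st) out → Good inp st (out ++ [ s ])
good-after-pop s≤inp g with stack-sorted g
... | s≤st ∷ st-sorted = record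
  { input-avoids = input-avoids g
  ; stack-unstraddled = All.tail (stack-unstraddled g)
  ; stack-sorted = st-sorted
  ; output-sorted = AllPairsₚ.++⁺ (output-sorted g) ([] ∷ [])
                      (All.map (λ { ((o≤s ∷ _) , _) → o≤s ∷ [] }) (output-below g))
  ; output-below = Allₚ.++⁺ (All.map (λ { ((_ ∷ o≤st) , o≤inp) → o≤st , o≤inp }) (output-below g))
                           ((s≤st , s≤inp) ∷ [])
  }

≤-head⇒≤-all : ∀ {x s st} → x ≤ s → WeaklyIncreasing (s ∷ st) → All (x ≤_) (s ∷ st)
≤-head⇒≤-all x≤s (s≤st ∷ _) = x≤s ∷ All.map (≤-trans x≤s) s≤st

good-top≤input : ∀ {x inp s st out} → Good (x ∷ inp) (s ∷ st) out → s < x → All (s ≤_) (x ∷ inp)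
good-top≤input g s<x = <⇒≤ s<x ∷ ¬straddles⇒lower-bound (All.head (stack-unstraddled g)) s<x

completable-push : ∀ {x inp st out} → Completable inp (x ∷ st) out → Completable (x ∷ inp) st out
completable-push (fin , run , sorted) = fin , step push run , sorted

completable-pop : ∀ {s inp st out} → Completable inp st (out ++ [ s ]) → Completable inp (s ∷ st) out
completable-pop (fin , run , sorted) = fin , step pop run , sorted

completable⇒good : ∀ {inp st out fin} →
                   Steps (inp , st , out) ([] , [] , fin) → WeaklyIncreasing fin → Good inp st out
completable⇒good done            sorted = good-final sorted
completable⇒good (step push run) sorted = good-before-push (completable⇒good run sorted)
completable⇒good (step pop run)  sorted = good-before-pop (completable⇒good run sorted)

good⇒completable : ∀ inp st {out} → Good inp st out → Completable inp st out
good⇒completable []        []       g = _ , done , output-sorted g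
good⇒completable (x ∷ inp) []       g = completable-push (good⇒completable inp [ x ] (good-after-push [] g))
good⇒completable []        (s ∷ st) g = completable-pop (good⇒completable [] st (good-after-pop [] g))
good⇒completable (x ∷ inp) (s ∷ st) g = [
  (λ x≤s → completable-push
     (good⇒completable inp (x ∷ s ∷ st) (good-after-push (≤-head⇒≤-all x≤s (stack-sorted g)) g))) ,
  (λ s<x → completable-pop
     (good⇒completable (x ∷ inp) st (good-after-pop (good-top≤input g s<x) g))) ]′ (≤-<-connex x s)

-- The characterisation holds for every word over ℕ.
mainTheorem2 : (e : List ℕ) → IsInversionSequence e → (StackSortable e ⇔ Avoids e pat120)
mainTheorem2 e _ = mk⇔
  (λ (_ , run , sorted) →
     input-avoids (completable⇒good run sorted) ∘ Equivalence.to contains-pat120⇔Contains120)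
  (λ avoids →
     good⇒completable e [] (good-initial (avoids ∘ Equivalence.from contains-pat120⇔Contains120)))
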